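{- Let $D\geq 3$ and $n\geq 1$ be integers, and let $A\subset(\mathbb{Z}/D\mathbb{Z})^{n}$ be a sunflower-free set. Then \[ |A|\leq c_D^{n},\qquad\text{where } c_D=\frac{3}{2^{2/3}}(D-1)^{2/3}. \]
   Context: For vectors $x,y,z\in(\mathbb{Z}/D\mathbb{Z})^n$ with coordinates $x_i,y_i,z_i$, the triple is called a sunflower if in each coordinate $i$ the three entries $x_i,y_i,z_i$ are either all equal or all distinct. A set $A\subset(\mathbb{Z}/D\mathbb{Z})^n$ is sunflower-free if for every three distinct elements $x,y,z\in A$ there exists a coordinate $i$ where exactly two of $x_i,y_i,z_i$ are equal (i.e. no three distinct elements of $A$ form a sunflower). -}

module Defs where

open import Data.Nat using (ℕ)
open import Data.Fin using (Fin)
open import Data.Vec using (Vec; lookup)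
open import Data.List using (List)
open import Data.List.Membership.Propositional using (_∈_)
open import Data.Product using (_×_)
open import Data.Sum using (_⊎_)
open import Relation.Binary.PropositionalEquality using (_≡_; _≢_)
open import Relation.Nullary using (¬_)

-- Elements of (ℤ/Dℤ)^n are represented as vectors of length n over Fin D
-- (the sunflower notion only uses equality of coordinates).
Vecs : ℕ → ℕ → Set
Vecs D n = Vec (Fin D) n

AllEqual : ∀ {D} → Fin D → Fin D → Fin D → Set
AllEqual a b c = a ≡ b × b ≡ c

AllDistinct : ∀ {D} → Fin D → Fin D → Fin D → Set
AllDistinct a b c = a ≢ b × b ≢ c × a ≢ c

Sunflower : ∀ {D n} → Vecs D n → Vecs D n → Vecs D n → Set
Sunflower {n = n} x y z =
  (i : Fin n) → AllEqual (lookup x i) (lookup y i) (lookup z i)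
              ⊎ AllDistinct (lookup x i) (lookup y i) (lookup z i)

SunflowerFree : ∀ {D n} → List (Vecs D n) → Set
SunflowerFree A = ∀ x y z → x ∈ A → y ∈ A → z ∈ A →
  x ≢ y → y ≢ z → x ≢ z → ¬ Sunflower x y z

module Submission where

-- Over 𝔽₃ the polynomial 1 − δ(a,b) − δ(b,c) − δ(a,c) is nonzero exactly when a, b, c are all equal
-- or all distinct, so the tensor T(x,y,z) = ∏ᵢ (1 − δ(xᵢ,yᵢ) − δ(yᵢ,zᵢ) − δ(xᵢ,zᵢ)) restricted to a
-- sunflower-free A is the diagonal tensor, whose slice rank is |A|.  Expanding each factor in the
-- basis 1, 𝟙[a = u] (u ≠ 0) of functions on ℤ/D writes T as a sum of products of monomials of total
-- degree ≤ 2n, so each term has a slot of degree ≤ 2n/3, and the slice rank is at most three times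
-- the number of such monomials.  A weighted count bounds this number for n = 3n′, giving
-- 4^n′ |A| ≤ 3 · 27^n′ (D − 1)^(2n′).  The tensor powers A^(3k) are again sunflower-free, and
-- letting k → ∞ removes the factor 3.

open import Defs
open import Data.Nat using (ℕ; zero; suc; _+_; _*_; _∸_; _^_; _≤_; _<_; z≤n; s≤s; >-nonZero)
open import Data.Nat.Properties
  using (≤-trans; ≤-reflexive; <-irrefl; <⇒≱; +-assoc; +-identityʳ; +-suc; *-comm; *-assoc; *-identityʳ; *-zeroʳ;
         *-suc; *-distribˡ-+; *-distribʳ-+; +-monoʳ-≤; +-monoˡ-≤; +-mono-≤; *-monoˡ-≤; *-monoʳ-≤; *-monoˡ-<;
         *-cancelʳ-≤; _≤?_; ≰⇒>; m≤m+n; m≤n+m; n≤1+n; n<1+n; ^-distribˡ-+-*; ^-*-assoc; ^-monoˡ-≤; m∸n+n≡m;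
         m^n≢0; module ≤-Reasoning)
import Data.Nat.Tactic.RingSolver as ℕ-Solver
open import Data.Fin using (Fin; zero; suc)
import Data.Fin.Properties as Fin
open import Data.Vec using ([]; _∷_) renaming (_++_ to _++ᵛ_)
import Data.Vec.Properties as Vec
open import Data.List using (List; []; _∷_; length; map; filter; cartesianProductWith; _++_)
import Data.List.Properties as List
open import Data.List.Membership.Propositional using (_∈_; find)
open import Data.List.Membership.Propositional.Properties
  using (∈-filter⁺; ∈-filter⁻; ∈-map⁺; ∈-++⁺ˡ; ∈-++⁺ʳ; ∈-cartesianProductWith⁻)
open import Data.List.Relation.Unary.Any as Any using (here; there; any?)
open import Data.List.Relation.Unary.All as All using (All; []; _∷_)
open import Data.List.Relation.Unary.AllPairs using ([]; _∷_)
open import Data.List.Relation.Unary.Unique.Propositional using (Unique)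
import Data.List.Relation.Unary.Unique.Propositional.Properties as Unique
open import Data.Product using (_×_; _,_; proj₁; proj₂)
open import Data.Sum using (_⊎_; inj₁; inj₂)
open import Data.Empty using (⊥-elim)
open import Data.Bool using (if_then_else_)
open import Data.Maybe using (Maybe; just; nothing)
open import Function using (_∘_; _∘′_)
open import Relation.Nullary using (Dec; yes; no; does; ¬_; contradiction)
open import Relation.Nullary.Decidable using (¬?; decidable-stable)
open import Relation.Unary using (Decidable)
open import Relation.Binary using (DecidableEquality)
open import Relation.Binary.PropositionalEquality
open import Algebra.Bundles using (CommutativeRing)
open import Algebra.Structures using (IsCommutativeRing)
open import Tactic.RingSolver.Core.AlmostCommutativeRing using (AlmostCommutativeRing; fromCommutativeRing)
open import Tactic.RingSolver using (solve-∀)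

data 𝔽₃ : Set where
  0₃ 1₃ 2₃ : 𝔽₃

infixl 7 _*₃_
infixl 6 _+₃_ _-₃_

_+₃_ : 𝔽₃ → 𝔽₃ → 𝔽₃
0₃ +₃ b  = b
1₃ +₃ 0₃ = 1₃
1₃ +₃ 1₃ = 2₃
1₃ +₃ 2₃ = 0₃
2₃ +₃ 0₃ = 2₃
2₃ +₃ 1₃ = 0₃
2₃ +₃ 2₃ = 1₃

neg₃ : 𝔽₃ → 𝔽₃
neg₃ 0₃ = 0₃
neg₃ 1₃ = 2₃
neg₃ 2₃ = 1₃

_-₃_ : 𝔽₃ → 𝔽₃ → 𝔽₃
a -₃ b = a +₃ neg₃ b

_*₃_ : 𝔽₃ → 𝔽₃ → 𝔽₃
0₃ *₃ b = 0₃
1₃ *₃ b = b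
2₃ *₃ b = neg₃ b

_≟₃_ : DecidableEquality 𝔽₃
0₃ ≟₃ 0₃ = yes refl
1₃ ≟₃ 1₃ = yes refl
2₃ ≟₃ 2₃ = yes refl
0₃ ≟₃ 1₃ = no λ ()
0₃ ≟₃ 2₃ = no λ ()
1₃ ≟₃ 0₃ = no λ ()
1₃ ≟₃ 2₃ = no λ ()
2₃ ≟₃ 0₃ = no λ ()
2₃ ≟₃ 1₃ = no λ ()

𝔽₃-cases : {P : 𝔽₃ → Set} → P 0₃ → P 1₃ → P 2₃ → ∀ a → P a
𝔽₃-cases p₀ p₁ p₂ 0₃ = p₀
𝔽₃-cases p₀ p₁ p₂ 1₃ = p₁
𝔽₃-cases p₀ p₁ p₂ 2₃ = p₂

𝔽₃-isCommutativeRing : IsCommutativeRing _≡_ _+₃_ _*₃_ neg₃ 0₃ 1₃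
𝔽₃-isCommutativeRing = record
  { isRing = record
    { +-isAbelianGroup = record
      { isGroup = record
        { isMonoid = record
          { isSemigroup = record
            { isMagma = record { isEquivalence = isEquivalence ; ∙-cong = cong₂ _+₃_ }
            ; assoc = 𝔽₃-cases (λ _ _ → refl) (cases² refl refl refl refl refl refl refl refl refl)
                                               (cases² refl refl refl refl refl refl refl refl refl) }
          ; identity = (λ _ → refl) , 𝔽₃-cases refl refl refl }
        ; inverse = 𝔽₃-cases refl refl refl , 𝔽₃-cases refl refl refl
        ; ⁻¹-cong = cong neg₃ }
      ; comm = cases² refl refl refl refl refl refl refl refl refl }
    ; *-cong = cong₂ _*₃_
    ; *-assoc = 𝔽₃-cases (λ _ _ → refl) (λ _ _ → refl) (cases² refl refl refl refl refl refl refl refl refl)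
    ; *-identity = (λ _ → refl) , 𝔽₃-cases refl refl refl
    ; distrib = 𝔽₃-cases (λ _ _ → refl) (λ _ _ → refl) (cases² refl refl refl refl refl refl refl refl refl)
              , 𝔽₃-cases (cases² refl refl refl refl refl refl refl refl refl)
                         (cases² refl refl refl refl refl refl refl refl refl)
                         (cases² refl refl refl refl refl refl refl refl refl) }
  ; *-comm = cases² refl refl refl refl refl refl refl refl refl }
  where
  cases² : {P : 𝔽₃ → 𝔽₃ → Set} → P 0₃ 0₃ → P 0₃ 1₃ → P 0₃ 2₃ → P 1₃ 0₃ → P 1₃ 1₃ → P 1₃ 2₃
         → P 2₃ 0₃ → P 2₃ 1₃ → P 2₃ 2₃ → ∀ a b → P a b
  cases² p₀₀ p₀₁ p₀₂ p₁₀ p₁₁ p₁₂ p₂₀ p₂₁ p₂₂ =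
    𝔽₃-cases (𝔽₃-cases p₀₀ p₀₁ p₀₂) (𝔽₃-cases p₁₀ p₁₁ p₁₂) (𝔽₃-cases p₂₀ p₂₁ p₂₂)

𝔽₃-commutativeRing : CommutativeRing _ _
𝔽₃-commutativeRing = record { isCommutativeRing = 𝔽₃-isCommutativeRing }

open CommutativeRing 𝔽₃-commutativeRing using ()
  renaming ( +-identityʳ to +₃-identityʳ; +-assoc to +₃-assoc; -‿inverseʳ to neg₃-inverseʳ
           ; *-identityˡ to *₃-identityˡ; *-identityʳ to *₃-identityʳ; *-assoc to *₃-assoc
           ; *-comm to *₃-comm; distribˡ to *₃-distribˡ-+₃; zeroˡ to *₃-zeroˡ; zeroʳ to *₃-zeroʳ)

𝔽₃-ring : AlmostCommutativeRing _ _
𝔽₃-ring = fromCommutativeRing 𝔽₃-commutativeRing 0≟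
  where
  0≟ : ∀ a → Maybe (0₃ ≡ a)
  0≟ 0₃ = just refl
  0≟ _  = nothing

x≢0⇒x*x≡1 : ∀ {a} → a ≢ 0₃ → a *₃ a ≡ 1₃
x≢0⇒x*x≡1 {0₃} a≢0 = ⊥-elim (a≢0 refl)
x≢0⇒x*x≡1 {1₃} _   = refl
x≢0⇒x*x≡1 {2₃} _   = refl

∑ : {X : Set} → List X → (X → 𝔽₃) → 𝔽₃
∑ []       f = 0₃
∑ (x ∷ xs) f = f x +₃ ∑ xs f

module _ {X : Set} where

  ∑-cong-∈ : (xs : List X) {f g : X → 𝔽₃} → (∀ {x} → x ∈ xs → f x ≡ g x) → ∑ xs f ≡ ∑ xs g
  ∑-cong-∈ []       eq = refl
  ∑-cong-∈ (x ∷ xs) eq = cong₂ _+₃_ (eq (here refl)) (∑-cong-∈ xs (eq ∘ there))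

  ∑-cong : (xs : List X) {f g : X → 𝔽₃} → (∀ x → f x ≡ g x) → ∑ xs f ≡ ∑ xs g
  ∑-cong xs eq = ∑-cong-∈ xs (λ {x} _ → eq x)

  ∑-zero : (xs : List X) {f : X → 𝔽₃} → (∀ {x} → x ∈ xs → f x ≡ 0₃) → ∑ xs f ≡ 0₃
  ∑-zero []       eq = refl
  ∑-zero (x ∷ xs) eq = cong₂ _+₃_ (eq (here refl)) (∑-zero xs (eq ∘ there))

  ∑-+ : (xs : List X) (f g : X → 𝔽₃) → ∑ xs (λ x → f x +₃ g x) ≡ ∑ xs f +₃ ∑ xs g
  ∑-+ []       f g = refl
  ∑-+ (x ∷ xs) f g = trans (cong (f x +₃ g x +₃_) (∑-+ xs f g)) (interchange (f x) (g x) (∑ xs f) (∑ xs g))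
    where
    interchange : ∀ a b c d → a +₃ b +₃ (c +₃ d) ≡ a +₃ c +₃ (b +₃ d)
    interchange = solve-∀ 𝔽₃-ring

  ∑-*ˡ : (xs : List X) (c : 𝔽₃) (f : X → 𝔽₃) → c *₃ ∑ xs f ≡ ∑ xs (λ x → c *₃ f x)
  ∑-*ˡ []       c f = *₃-zeroʳ c
  ∑-*ˡ (x ∷ xs) c f = trans (*₃-distribˡ-+₃ c (f x) (∑ xs f)) (cong (c *₃ f x +₃_) (∑-*ˡ xs c f))

  ∑-*ʳ : (xs : List X) (c : 𝔽₃) (f : X → 𝔽₃) → ∑ xs f *₃ c ≡ ∑ xs (λ x → f x *₃ c)
  ∑-*ʳ xs c f = trans (*₃-comm _ c) (trans (∑-*ˡ xs c f) (∑-cong xs (λ x → *₃-comm c (f x))))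

  ∑-factor : (xs : List X) (c : 𝔽₃) {f g : X → 𝔽₃} → (∀ x → f x ≡ c *₃ g x) → ∑ xs f ≡ c *₃ ∑ xs g
  ∑-factor xs c {g = g} eq = trans (∑-cong xs eq) (sym (∑-*ˡ xs c g))

  ∑-neg : (xs : List X) (f : X → 𝔽₃) → ∑ xs (λ x → neg₃ (f x)) ≡ neg₃ (∑ xs f)
  ∑-neg []       f = refl
  ∑-neg (x ∷ xs) f = trans (cong (neg₃ (f x) +₃_) (∑-neg xs f)) (neg-+ (f x) (∑ xs f))
    where
    neg-+ : ∀ a b → neg₃ a +₃ neg₃ b ≡ neg₃ (a +₃ b)
    neg-+ = solve-∀ 𝔽₃-ring

  ∑-- : (xs : List X) (f g : X → 𝔽₃) → ∑ xs (λ x → f x -₃ g x) ≡ ∑ xs f -₃ ∑ xs g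
  ∑-- xs f g = trans (∑-+ xs f (λ x → neg₃ (g x))) (cong (∑ xs f +₃_) (∑-neg xs g))

  ∑-++ : (xs ys : List X) (f : X → 𝔽₃) → ∑ (xs ++ ys) f ≡ ∑ xs f +₃ ∑ ys f
  ∑-++ []       ys f = refl
  ∑-++ (x ∷ xs) ys f = trans (cong (f x +₃_) (∑-++ xs ys f)) (sym (+₃-assoc (f x) _ _))

  ∑-single : (xs : List X) {f : X → 𝔽₃} {j : X} → Unique xs → j ∈ xs →
             (∀ {x} → x ∈ xs → x ≢ j → f x ≡ 0₃) → ∑ xs f ≡ f j
  ∑-single (x ∷ xs) {f} (x∉xs ∷ _) (here refl) eq =
    trans (cong (f x +₃_) (∑-zero xs (λ p → eq (there p) (λ { refl → All.lookup x∉xs p refl }))))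
          (+₃-identityʳ _)
  ∑-single (x ∷ xs) (x∉xs ∷ uxs) (there p) eq =
    cong₂ _+₃_ (eq (here refl) (All.lookup x∉xs p)) (∑-single xs uxs p (eq ∘ there))

∑-map : {X Y : Set} (h : X → Y) (xs : List X) (f : Y → 𝔽₃) → ∑ (map h xs) f ≡ ∑ xs (f ∘ h)
∑-map h []       f = refl
∑-map h (x ∷ xs) f = cong (f (h x) +₃_) (∑-map h xs f)

∑-swap : {X Y : Set} (xs : List X) (ys : List Y) (f : X → Y → 𝔽₃) →
         ∑ xs (λ x → ∑ ys (f x)) ≡ ∑ ys (λ y → ∑ xs (λ x → f x y))
∑-swap []       ys f = sym (∑-zero ys (λ _ → refl))
∑-swap (x ∷ xs) ys f = trans (cong (∑ ys (f x) +₃_) (∑-swap xs ys f)) (sym (∑-+ ys (f x) _))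

∑-cartesianProductWith : {X Y Z : Set} (g : X → Y → Z) (xs : List X) (ys : List Y) (f : Z → 𝔽₃) →
                         ∑ (cartesianProductWith g xs ys) f ≡ ∑ xs (λ x → ∑ ys (λ y → f (g x y)))
∑-cartesianProductWith g []       ys f = refl
∑-cartesianProductWith g (x ∷ xs) ys f =
  trans (∑-++ (map (g x) ys) _ f) (cong₂ _+₃_ (∑-map (g x) ys f) (∑-cartesianProductWith g xs ys f))

module Kronecker {X : Set} (_≟_ : DecidableEquality X) where

  δ : X → X → 𝔽₃
  δ a b = if does (a ≟ b) then 1₃ else 0₃

  δ-≡ : ∀ {a b} → a ≡ b → δ a b ≡ 1₃
  δ-≡ {a} {b} a≡b with a ≟ b
  ... | yes _   = refl
  ... | no  a≢b = ⊥-elim (a≢b a≡b)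

  δ-≢ : ∀ {a b} → a ≢ b → δ a b ≡ 0₃
  δ-≢ {a} {b} a≢b with a ≟ b
  ... | yes a≡b = ⊥-elim (a≢b a≡b)
  ... | no  _   = refl

module KernelBasis {X : Set} (_≟_ : DecidableEquality X) where

  open Kronecker _≟_

  pairing : List X → (X → 𝔽₃) → (X → 𝔽₃) → 𝔽₃
  pairing S k w = ∑ S (λ y → k y *₃ w y)

  pairing-linear : ∀ S k (u v : X → 𝔽₃) c → pairing S k (λ y → u y -₃ c *₃ v y) ≡ pairing S k u -₃ c *₃ pairing S k v
  pairing-linear S k u v c = begin
      ∑ S (λ y → k y *₃ (u y -₃ c *₃ v y))
    ≡⟨ ∑-cong S (λ y → distrib (k y) (u y) (v y) c) ⟩
      ∑ S (λ y → k y *₃ u y -₃ c *₃ (k y *₃ v y))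
    ≡⟨ ∑-- S _ _ ⟩
      pairing S k u -₃ ∑ S (λ y → c *₃ (k y *₃ v y))
    ≡⟨ cong (pairing S k u -₃_) (sym (∑-*ˡ S c _)) ⟩
      pairing S k u -₃ c *₃ pairing S k v ∎
    where
    open ≡-Reasoning
    distrib : ∀ k u v c → k *₃ (u -₃ c *₃ v) ≡ k *₃ u -₃ c *₃ (k *₃ v)
    distrib = solve-∀ 𝔽₃-ring

  record Basis (S : List X) (ks : List (X → 𝔽₃)) : Set where
    field
      pivots         : List X
      pivots-unique  : Unique pivots
      pivots⊆S       : ∀ {j} → j ∈ pivots → j ∈ S
      dimension      : length S ≤ length pivots + length ks
      vector         : X → X → 𝔽₃
      annihilated    : ∀ {j} → j ∈ pivots → ∀ {k} → k ∈ ks → pairing S k (vector j) ≡ 0₃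
      vector-pivot   : ∀ {j} → j ∈ pivots → vector j j ≡ 1₃
      vector-other   : ∀ {j j′} → j ∈ pivots → j′ ∈ pivots → j ≢ j′ → vector j j′ ≡ 0₃

  remove : X → List X → List X
  remove x = filter (λ y → ¬? (y ≟ x))

  ∈-remove⁻ : ∀ {x y xs} → y ∈ remove x xs → y ∈ xs × y ≢ x
  ∈-remove⁻ {x} = ∈-filter⁻ (λ y → ¬? (y ≟ x))

  length-remove : ∀ x (xs : List X) → Unique xs → length xs ≤ suc (length (remove x xs))
  length-remove x []       _           = z≤n
  length-remove x (y ∷ xs) (y∉xs ∷ u) with y ≟ x
  ... | no  _    = s≤s (length-remove x xs u)
  ... | yes refl = s≤s (≤-reflexive (sym (remove-absent xs y∉xs)))
    where
    remove-absent : ∀ ys → All (y ≢_) ys → length (remove y ys) ≡ length ys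
    remove-absent []       _           = refl
    remove-absent (z ∷ ys) (y≢z ∷ ps) with z ≟ y
    ... | yes z≡y = ⊥-elim (y≢z (sym z≡y))
    ... | no  _   = cong suc (remove-absent ys ps)

  standardBasis : (S : List X) → Unique S → Basis S []
  standardBasis S uS = record
    { pivots = S ; pivots-unique = uS ; pivots⊆S = λ p → p ; dimension = ≤-reflexive (sym (+-identityʳ _))
    ; vector = δ ; annihilated = λ _ () ; vector-pivot = λ _ → δ-≡ refl ; vector-other = λ _ _ → δ-≢ }

  module _ {S : List X} {ks : List (X → 𝔽₃)} (k : X → 𝔽₃) (E : Basis S ks) where

    open Basis E

    addAnnihilated : (∀ {j} → j ∈ pivots → pairing S k (vector j) ≡ 0₃) → Basis S (k ∷ ks)
    addAnnihilated k⊥ = record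
      { pivots = pivots ; pivots-unique = pivots-unique ; pivots⊆S = pivots⊆S
      ; dimension = ≤-trans dimension (+-monoʳ-≤ (length pivots) (n≤1+n _))
      ; vector = vector ; annihilated = annihilated′ ; vector-pivot = vector-pivot ; vector-other = vector-other }
      where
      annihilated′ : ∀ {j} → j ∈ pivots → ∀ {k′} → k′ ∈ k ∷ ks → pairing S k′ (vector j) ≡ 0₃
      annihilated′ p (here refl) = k⊥ p
      annihilated′ p (there q)   = annihilated p q

    -- Gaussian elimination: subtract multiples of vector j₀ so that k annihilates every other
    -- vector; the pivot j₀ is dropped.  Over 𝔽₃ the inverse of p = ⟨k, vector j₀⟩ is p itself.
    eliminate : ∀ {j₀} → j₀ ∈ pivots → pairing S k (vector j₀) ≢ 0₃ → Basis S (k ∷ ks)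
    eliminate {j₀} j₀∈ p≢0 = record
      { pivots = remove j₀ pivots
      ; pivots-unique = Unique.filter⁺ (λ y → ¬? (y ≟ j₀)) pivots-unique
      ; pivots⊆S = pivots⊆S ∘ proj₁ ∘ removed
      ; dimension = ≤-trans dimension (≤-trans (+-monoˡ-≤ (length ks) (length-remove j₀ pivots pivots-unique))
                                                (≤-reflexive (sym (+-suc _ _))))
      ; vector = vector′ ; annihilated = annihilated′ ; vector-pivot = vector-pivot′ ; vector-other = vector-other′ }
      where
      removed : ∀ {j} → j ∈ remove j₀ pivots → j ∈ pivots × j ≢ j₀
      removed = ∈-remove⁻ {xs = pivots}

      p : 𝔽₃
      p = pairing S k (vector j₀)

      c : X → 𝔽₃
      c j = pairing S k (vector j) *₃ p

      vector′ : X → X → 𝔽₃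
      vector′ j y = vector j y -₃ c j *₃ vector j₀ y

      j₀-other : ∀ {j} → j ∈ remove j₀ pivots → vector j₀ j ≡ 0₃
      j₀-other q = vector-other j₀∈ (proj₁ (removed q)) (λ e → proj₂ (removed q) (sym e))

      annihilated′ : ∀ {j} → j ∈ remove j₀ pivots → ∀ {k′} → k′ ∈ k ∷ ks → pairing S k′ (vector′ j) ≡ 0₃
      annihilated′ {j} q {k′} r = trans (pairing-linear S k′ (vector j) (vector j₀) (c j)) (cancel r)
        where
        cancel : k′ ∈ k ∷ ks → pairing S k′ (vector j) -₃ c j *₃ pairing S k′ (vector j₀) ≡ 0₃
        cancel (here refl) = cancel-p (pairing S k (vector j)) p (x≢0⇒x*x≡1 p≢0)
          where
          cancel-p : ∀ a p → p *₃ p ≡ 1₃ → a -₃ a *₃ p *₃ p ≡ 0₃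
          cancel-p a p p²≡1 rewrite *₃-assoc a p p | p²≡1 | *₃-identityʳ a = neg₃-inverseʳ a
        cancel (there r′) rewrite annihilated (proj₁ (removed q)) r′ | annihilated j₀∈ r′ | *₃-zeroʳ (c j) = refl

      vector-pivot′ : ∀ {j} → j ∈ remove j₀ pivots → vector′ j j ≡ 1₃
      vector-pivot′ {j} q rewrite vector-pivot (proj₁ (removed q)) | j₀-other q | *₃-zeroʳ (c j) = refl

      vector-other′ : ∀ {j j′} → j ∈ remove j₀ pivots → j′ ∈ remove j₀ pivots → j ≢ j′ → vector′ j j′ ≡ 0₃
      vector-other′ {j} q q′ j≢j′
        rewrite vector-other (proj₁ (removed q)) (proj₁ (removed q′)) j≢j′ | j₀-other q′ | *₃-zeroʳ (c j) = refl

  basis : (S : List X) → Unique S → (ks : List (X → 𝔽₃)) → Basis S ks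
  basis S uS []       = standardBasis S uS
  basis S uS (k ∷ ks) with E ← basis S uS ks
    with any? (λ j → ¬? (pairing S k (Basis.vector E j) ≟₃ 0₃)) (Basis.pivots E)
  ... | yes found = let j₀ , j₀∈ , p≢0 = find found in eliminate k E j₀∈ p≢0
  ... | no  none  = addAnnihilated k E k⊥
    where
    k⊥ : ∀ {j} → j ∈ Basis.pivots E → pairing S k (Basis.vector E j) ≡ 0₃
    k⊥ {j} j∈ = decidable-stable (pairing S k (Basis.vector E j) ≟₃ 0₃) (λ p≢0 → none (Any.map (λ { refl → p≢0 }) j∈))

∑³ : {I : Set} → List I → (I → I → I → 𝔽₃) → 𝔽₃
∑³ is F = ∑ is (λ α → ∑ is (λ β → ∑ is (F α β)))

module _ {I : Set} (is : List I) where

  ∑³-cong : {F G : I → I → I → 𝔽₃} → (∀ α β γ → F α β γ ≡ G α β γ) → ∑³ is F ≡ ∑³ is G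
  ∑³-cong eq = ∑-cong is (λ α → ∑-cong is (λ β → ∑-cong is (eq α β)))

  ∑³-*ˡ : ∀ c F → c *₃ ∑³ is F ≡ ∑³ is (λ α β γ → c *₃ F α β γ)
  ∑³-*ˡ c F = trans (∑-*ˡ is c _) (∑-cong is (λ α → trans (∑-*ˡ is c _) (∑-cong is (λ β → ∑-*ˡ is c (F α β)))))

  ∑³-*ʳ : ∀ c F → ∑³ is F *₃ c ≡ ∑³ is (λ α β γ → F α β γ *₃ c)
  ∑³-*ʳ c F = trans (∑-*ʳ is c _) (∑-cong is (λ α → trans (∑-*ʳ is c _) (∑-cong is (λ β → ∑-*ʳ is c (F α β)))))

  ∑-∑³-swap : {Y : Set} (ys : List Y) (F : Y → I → I → I → 𝔽₃) →
              ∑ ys (λ y → ∑³ is (F y)) ≡ ∑³ is (λ α β γ → ∑ ys (λ y → F y α β γ))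
  ∑-∑³-swap ys F =
    trans (∑-swap ys is _) (∑-cong is (λ α →
    trans (∑-swap ys is _) (∑-cong is (λ β → ∑-swap ys is (λ y γ → F y α β γ)))))

∑³-- : {I : Set} (is : List I) (F G : I → I → I → 𝔽₃) → ∑³ is (λ α β γ → F α β γ -₃ G α β γ) ≡ ∑³ is F -₃ ∑³ is G
∑³-- is F G = trans (∑-cong is (λ α → trans (∑-cong is (λ β → ∑-- is (F α β) (G α β))) (∑-- is _ _))) (∑-- is _ _)

∑³-cartesianProductWith : {I J K : Set} (g : I → J → K) (is : List I) (js : List J) (F : K → K → K → 𝔽₃) →
  ∑³ (cartesianProductWith g is js) F ≡ ∑³ is (λ u v w → ∑³ js (λ α β γ → F (g u α) (g v β) (g w γ)))
∑³-cartesianProductWith g is js F = begin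
    ∑³ (cartesianProductWith g is js) F
  ≡⟨ trans ∑-cart (∑-cong is (λ u → ∑-cong js (λ α → trans ∑-cart (∑-cong is (λ v → ∑-cong js (λ β → ∑-cart)))))) ⟩
    ∑ is (λ u → ∑ js (λ α → ∑ is (λ v → ∑ js (λ β → ∑ is (λ w → ∑ js (λ γ → F (g u α) (g v β) (g w γ)))))))
  ≡⟨ ∑-cong is (λ u → trans (∑-swap js is _) (∑-cong is (λ v → ∑-cong js (λ α → ∑-swap js is _)))) ⟩
    ∑ is (λ u → ∑ is (λ v → ∑ js (λ α → ∑ is (λ w → ∑ js (λ β → ∑ js (λ γ → F (g u α) (g v β) (g w γ)))))))
  ≡⟨ ∑-cong is (λ u → ∑-cong is (λ v → ∑-swap js is _)) ⟩
    ∑³ is (λ u v w → ∑³ js (λ α β γ → F (g u α) (g v β) (g w γ))) ∎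
  where
  open ≡-Reasoning
  ∑-cart : ∀ {f} → ∑ (cartesianProductWith g is js) f ≡ ∑ is (λ u → ∑ js (λ α → f (g u α)))
  ∑-cart {f} = ∑-cartesianProductWith g is js f

trilinear : {X I : Set} → List I → (I → X → 𝔽₃) → (I → I → I → 𝔽₃) → X → X → X → 𝔽₃
trilinear is m c x y z = ∑³ is (λ α β γ → c α β γ *₃ (m α x *₃ (m β y *₃ m γ z)))

-- The slice-rank bound |A| ≤ 3 · |small| for a diagonal trilinear form each of whose terms has a
-- small monomial in some slot.  Were |A| larger, the two kernel bases below would leave a pivot j,
-- and Q = ∑ w(y) T(j,y,z) h(z) would be 1 by diagonality but 0 term by term in the expansion of T.
module SliceRank {X I : Set} (_≟_ : DecidableEquality X)
  (is : List I) (m : I → X → 𝔽₃) (c : I → I → I → 𝔽₃)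
  {Small : I → Set} (small? : Decidable Small)
  (small-slot : ∀ α β γ → c α β γ ≢ 0₃ → Small α ⊎ Small β ⊎ Small γ)
  (A : List X) (uA : Unique A)
  (diagonal : ∀ {x y z} → x ∈ A → y ∈ A → z ∈ A →
              trilinear is m c x y z ≡ Kronecker.δ _≟_ x y *₃ Kronecker.δ _≟_ y z)
  where

  open Kronecker _≟_
  open KernelBasis _≟_

  small : List I
  small = filter small? is

  ∈-small : ∀ {α} → α ∈ is → Small α → α ∈ small
  ∈-small = ∈-filter⁺ small?

  E₁ : Basis A (map m small)
  E₁ = basis A uA (map m small)

  open Basis E₁ using () renaming (pivots to J₁; pivots-unique to J₁-unique; pivots⊆S to J₁⊆A)

  h : X → 𝔽₃
  h z = ∑ J₁ (λ j → Basis.vector E₁ j z)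

  h-moment : I → 𝔽₃
  h-moment γ = ∑ A (λ z → m γ z *₃ h z)

  h-moment-small : ∀ {γ} → γ ∈ small → h-moment γ ≡ 0₃
  h-moment-small {γ} γ∈ = begin
      ∑ A (λ z → m γ z *₃ ∑ J₁ (λ j → Basis.vector E₁ j z))
    ≡⟨ ∑-cong A (λ z → ∑-*ˡ J₁ (m γ z) _) ⟩
      ∑ A (λ z → ∑ J₁ (λ j → m γ z *₃ Basis.vector E₁ j z))
    ≡⟨ ∑-swap A J₁ _ ⟩
      ∑ J₁ (λ j → pairing A (m γ) (Basis.vector E₁ j))
    ≡⟨ ∑-zero J₁ (λ j∈ → Basis.annihilated E₁ j∈ (∈-map⁺ m γ∈)) ⟩
      0₃ ∎
    where open ≡-Reasoning

  h-pivot : ∀ {j} → j ∈ J₁ → h j ≡ 1₃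
  h-pivot j∈ = trans (∑-single J₁ J₁-unique j∈ (λ j′∈ j′≢j → Basis.vector-other E₁ j′∈ j∈ j′≢j))
                     (Basis.vector-pivot E₁ j∈)

  -- On J₁, kill the α-slices of the form (with h in the z-slot) and the monomials, for all small α.
  slice : I → X → 𝔽₃
  slice α y = ∑ is (λ β → ∑ is (λ γ → c α β γ *₃ (m β y *₃ h-moment γ)))

  E₂ : Basis J₁ (map slice small ++ map m small)
  E₂ = basis J₁ J₁-unique (map slice small ++ map m small)

  module _ {j} (j∈ : j ∈ Basis.pivots E₂) where

    open ≡-Reasoning

    w : X → 𝔽₃
    w = Basis.vector E₂ j

    j∈J₁ : j ∈ J₁
    j∈J₁ = Basis.pivots⊆S E₂ j∈

    j∈A : j ∈ A
    j∈A = J₁⊆A j∈J₁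

    Q : 𝔽₃
    Q = ∑ J₁ (λ y → w y *₃ ∑ A (λ z → δ j y *₃ δ y z *₃ h z))

    Q≡1 : Q ≡ 1₃
    Q≡1 = begin
        Q
      ≡⟨ ∑-cong-∈ J₁ (λ y∈ → cong (w _ *₃_) (inner y∈)) ⟩
        ∑ J₁ (λ y → w y *₃ (δ j y *₃ h y))
      ≡⟨ ∑-single J₁ J₁-unique j∈J₁ (λ {y} _ y≢j →
           trans (cong (λ t → w y *₃ (t *₃ h y)) (δ-≢ (λ e → y≢j (sym e)))) (*₃-zeroʳ (w y))) ⟩
        w j *₃ (δ j j *₃ h j)
      ≡⟨ cong₂ (λ a b → a *₃ (b *₃ h j)) (Basis.vector-pivot E₂ j∈) (δ-≡ refl) ⟩
        1₃ *₃ (1₃ *₃ h j)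
      ≡⟨ h-pivot j∈J₁ ⟩
        1₃ ∎
      where
      inner : ∀ {y} → y ∈ J₁ → ∑ A (λ z → δ j y *₃ δ y z *₃ h z) ≡ δ j y *₃ h y
      inner {y} y∈ = begin
          ∑ A (λ z → δ j y *₃ δ y z *₃ h z)
        ≡⟨ ∑-factor A (δ j y) (λ z → *₃-assoc (δ j y) (δ y z) (h z)) ⟩
          δ j y *₃ ∑ A (λ z → δ y z *₃ h z)
        ≡⟨ cong (δ j y *₃_) (∑-single A uA (J₁⊆A y∈)
             (λ {z} _ z≢y → trans (cong (_*₃ h z) (δ-≢ (λ e → z≢y (sym e)))) (*₃-zeroˡ (h z)))) ⟩
          δ j y *₃ (δ y y *₃ h y)
        ≡⟨ cong (λ t → δ j y *₃ (t *₃ h y)) (δ-≡ refl) ⟩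
          δ j y *₃ (1₃ *₃ h y) ∎

    w-moment : I → 𝔽₃
    w-moment β = pairing J₁ (m β) w

    w-moment-small : ∀ {β} → β ∈ small → w-moment β ≡ 0₃
    w-moment-small β∈ = Basis.annihilated E₂ j∈ (∈-++⁺ʳ (map slice small) (∈-map⁺ m β∈))

    slice-small : ∀ {α} → α ∈ small → pairing J₁ (slice α) w ≡ 0₃
    slice-small α∈ = Basis.annihilated E₂ j∈ (∈-++⁺ˡ (∈-map⁺ slice α∈))

    summand : I → I → I → 𝔽₃
    summand α β γ = c α β γ *₃ (m α j *₃ (w-moment β *₃ h-moment γ))

    Q-expand : Q ≡ ∑³ is summand
    Q-expand = begin
        Q
      ≡⟨ ∑-cong-∈ J₁ (λ y∈ → cong (w _ *₃_) (∑-cong-∈ A (λ z∈ →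
           cong (_*₃ h _) (sym (diagonal j∈A (J₁⊆A y∈) z∈))))) ⟩
        ∑ J₁ (λ y → w y *₃ ∑ A (λ z → trilinear is m c j y z *₃ h z))
      ≡⟨ ∑-cong J₁ (λ y → cong (w y *₃_) (∑-cong A (λ z → ∑³-*ʳ is (h z) _))) ⟩
        ∑ J₁ (λ y → w y *₃ ∑ A (λ z → ∑³ is (λ α β γ → term y z α β γ *₃ h z)))
      ≡⟨ ∑-cong J₁ (λ y → cong (w y *₃_) (∑-∑³-swap is A _)) ⟩
        ∑ J₁ (λ y → w y *₃ ∑³ is (λ α β γ → ∑ A (λ z → term y z α β γ *₃ h z)))
      ≡⟨ ∑-cong J₁ (λ y → ∑³-*ˡ is (w y) _) ⟩
        ∑ J₁ (λ y → ∑³ is (λ α β γ → w y *₃ ∑ A (λ z → term y z α β γ *₃ h z)))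
      ≡⟨ ∑-∑³-swap is J₁ _ ⟩
        ∑³ is (λ α β γ → ∑ J₁ (λ y → w y *₃ ∑ A (λ z → term y z α β γ *₃ h z)))
      ≡⟨ ∑³-cong is factor ⟩
        ∑³ is summand ∎
      where
      term : X → X → I → I → I → 𝔽₃
      term y z α β γ = c α β γ *₃ (m α j *₃ (m β y *₃ m γ z))
      factor : ∀ α β γ → ∑ J₁ (λ y → w y *₃ ∑ A (λ z → term y z α β γ *₃ h z)) ≡ summand α β γ
      factor α β γ = begin
          ∑ J₁ (λ y → w y *₃ ∑ A (λ z → term y z α β γ *₃ h z))
        ≡⟨ ∑-cong J₁ (λ y → cong (w y *₃_) (∑-factor A (c α β γ *₃ m α j *₃ m β y)
             (λ z → regroup₁ (c α β γ) (m α j) (m β y) (m γ z) (h z)))) ⟩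
          ∑ J₁ (λ y → w y *₃ (c α β γ *₃ m α j *₃ m β y *₃ h-moment γ))
        ≡⟨ ∑-factor J₁ (c α β γ *₃ m α j *₃ h-moment γ) (λ y → regroup₂ (w y) (c α β γ) (m α j) (m β y) (h-moment γ)) ⟩
          c α β γ *₃ m α j *₃ h-moment γ *₃ w-moment β
        ≡⟨ regroup₃ (c α β γ) (m α j) (h-moment γ) (w-moment β) ⟩
          summand α β γ ∎
        where
        regroup₁ : ∀ c a b g hz → c *₃ (a *₃ (b *₃ g)) *₃ hz ≡ c *₃ a *₃ b *₃ (g *₃ hz)
        regroup₁ = solve-∀ 𝔽₃-ring
        regroup₂ : ∀ wy c a b G → wy *₃ (c *₃ a *₃ b *₃ G) ≡ c *₃ a *₃ G *₃ (b *₃ wy)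
        regroup₂ = solve-∀ 𝔽₃-ring
        regroup₃ : ∀ c a G B → c *₃ a *₃ G *₃ B ≡ c *₃ (a *₃ (B *₃ G))
        regroup₃ = solve-∀ 𝔽₃-ring

    α-slice : ∀ α → ∑ is (λ β → ∑ is (summand α β)) ≡ m α j *₃ pairing J₁ (slice α) w
    α-slice α = sym (begin
        m α j *₃ ∑ J₁ (λ y → ∑ is (λ β → ∑ is (λ γ → c α β γ *₃ (m β y *₃ h-moment γ))) *₃ w y)
      ≡⟨ cong (m α j *₃_) (∑-cong J₁ (λ y → trans (∑-*ʳ is (w y) _) (∑-cong is (λ β → ∑-*ʳ is (w y) _)))) ⟩
        m α j *₃ ∑ J₁ (λ y → ∑ is (λ β → ∑ is (λ γ → c α β γ *₃ (m β y *₃ h-moment γ) *₃ w y)))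
      ≡⟨ cong (m α j *₃_) (trans (∑-swap J₁ is _) (∑-cong is (λ β → ∑-swap J₁ is _))) ⟩
        m α j *₃ ∑ is (λ β → ∑ is (λ γ → ∑ J₁ (λ y → c α β γ *₃ (m β y *₃ h-moment γ) *₃ w y)))
      ≡⟨ cong (m α j *₃_) (∑-cong is (λ β → ∑-cong is (λ γ →
           ∑-factor J₁ (c α β γ *₃ h-moment γ) (λ y → regroup₁ (c α β γ) (m β y) (h-moment γ) (w y))))) ⟩
        m α j *₃ ∑ is (λ β → ∑ is (λ γ → c α β γ *₃ h-moment γ *₃ w-moment β))
      ≡⟨ trans (∑-*ˡ is (m α j) _) (∑-cong is (λ β → ∑-*ˡ is (m α j) _)) ⟩
        ∑ is (λ β → ∑ is (λ γ → m α j *₃ (c α β γ *₃ h-moment γ *₃ w-moment β)))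
      ≡⟨ ∑-cong is (λ β → ∑-cong is (λ γ → regroup₂ (m α j) (c α β γ) (h-moment γ) (w-moment β))) ⟩
        ∑ is (λ β → ∑ is (summand α β)) ∎)
      where
      regroup₁ : ∀ c b G wy → c *₃ (b *₃ G) *₃ wy ≡ c *₃ G *₃ (b *₃ wy)
      regroup₁ = solve-∀ 𝔽₃-ring
      regroup₂ : ∀ a c G B → a *₃ (c *₃ G *₃ B) ≡ c *₃ (a *₃ (B *₃ G))
      regroup₂ = solve-∀ 𝔽₃-ring

    α-slice-vanishes : ∀ {α} → α ∈ is → ∑ is (λ β → ∑ is (summand α β)) ≡ 0₃
    α-slice-vanishes {α} α∈ with small? α
    ... | yes α-small = trans (α-slice α) (trans (cong (m α j *₃_) (slice-small (∈-small α∈ α-small))) (*₃-zeroʳ (m α j)))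
    ... | no  α-large = ∑-zero is (λ β∈ → ∑-zero is (λ γ∈ → vanishes β∈ γ∈))
      where
      vanishes : ∀ {β γ} → β ∈ is → γ ∈ is → summand α β γ ≡ 0₃
      vanishes {β} {γ} β∈ γ∈ with c α β γ ≟₃ 0₃
      ... | yes c≡0 = trans (cong (_*₃ (m α j *₃ (w-moment β *₃ h-moment γ))) c≡0) (*₃-zeroˡ (m α j *₃ (w-moment β *₃ h-moment γ)))
      ... | no  c≢0 with small-slot α β γ c≢0
      ...   | inj₁ α-small        = ⊥-elim (α-large α-small)
      ...   | inj₂ (inj₁ β-small) rewrite w-moment-small (∈-small β∈ β-small) = kill (c α β γ) (m α j) (h-moment γ)
        where kill : ∀ c a g → c *₃ (a *₃ (0₃ *₃ g)) ≡ 0₃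
              kill = solve-∀ 𝔽₃-ring
      ...   | inj₂ (inj₂ γ-small) rewrite h-moment-small (∈-small γ∈ γ-small) = kill (c α β γ) (m α j) (w-moment β)
        where kill : ∀ c a b → c *₃ (a *₃ (b *₃ 0₃)) ≡ 0₃
              kill = solve-∀ 𝔽₃-ring

    Q≡0 : Q ≡ 0₃
    Q≡0 = trans Q-expand (∑-zero is α-slice-vanishes)

  no-second-pivots : Basis.pivots E₂ ≡ []
  no-second-pivots with Basis.pivots E₂ | Q≡1 | Q≡0
  ... | []    | _   | _   = refl
  ... | _ ∷ _ | Q≡1 | Q≡0 with () ← trans (sym (Q≡1 (here refl))) (Q≡0 (here refl))

  bound : length A ≤ 3 * length small
  bound = ≤-trans (Basis.dimension E₁) (≤-trans (+-monoˡ-≤ (length (map m small)) (Basis.dimension E₂))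
            (≤-reflexive count))
    where
    count : length (Basis.pivots E₂) + length (map slice small ++ map m small) + length (map m small) ≡ 3 * length small
    count rewrite no-second-pivots | List.length-++ (map slice small) {map m small}
                | List.length-map slice small | List.length-map m small = triple (length small)
      where
      triple : ∀ l → l + l + l ≡ 3 * l
      triple = ℕ-Solver.solve-∀

sunflower-equal⊎distinct : ∀ {D n} (x y z : Vecs D n) → Sunflower x y z →
                           (x ≡ y × y ≡ z) ⊎ (x ≢ y × y ≢ z × x ≢ z)
sunflower-equal⊎distinct [] [] [] s = inj₁ (refl , refl)
sunflower-equal⊎distinct (a ∷ x) (b ∷ y) (c ∷ z) s with s zero | sunflower-equal⊎distinct x y z (λ i → s (suc i))
... | inj₂ (a≢b , b≢c , a≢c) | _ = inj₂ (a≢b ∘′ Vec.∷-injectiveˡ , b≢c ∘′ Vec.∷-injectiveˡ , a≢c ∘′ Vec.∷-injectiveˡ)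
... | inj₁ (refl , refl) | inj₁ (refl , refl) = inj₁ (refl , refl)
... | inj₁ (refl , refl) | inj₂ (x≢y , y≢z , x≢z) = inj₂ (x≢y ∘′ Vec.∷-injectiveʳ , y≢z ∘′ Vec.∷-injectiveʳ , x≢z ∘′ Vec.∷-injectiveʳ)

fins : (k : ℕ) → List (Fin k)
fins zero    = []
fins (suc k) = zero ∷ map suc (fins k)

δ-fin : ∀ {k} → Fin k → Fin k → 𝔽₃
δ-fin = Kronecker.δ Fin._≟_

∑-δ-fin : ∀ k (g : Fin k → 𝔽₃) a → ∑ (fins k) (λ u → g u *₃ δ-fin u a) ≡ g a
∑-δ-fin (suc k) g zero
  rewrite ∑-map suc (fins k) (λ u → g u *₃ δ-fin u zero)
        | ∑-zero (fins k) {λ u → g (suc u) *₃ δ-fin (suc u) zero} (λ {u} _ → *₃-zeroʳ (g (suc u)))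
        = trans (+₃-identityʳ _) (*₃-identityʳ _)
∑-δ-fin (suc k) g (suc a)
  rewrite ∑-map suc (fins k) (λ u → g u *₃ δ-fin u (suc a))
        | ∑-δ-fin k (λ u → g (suc u)) a | *₃-zeroʳ (g zero) = refl

-- Functions on Fin D over 𝔽₃, in the basis  1, 𝟙[a = 1], …, 𝟙[a = D − 1];  basis vector u has
-- degree 0 if u = 0 and degree 1 otherwise, and a monomial on (Fin D)^N is a product of basis vectors.
module SunflowerPolynomial (m : ℕ) where

  D : ℕ
  D = suc m

  basis : Fin D → Fin D → 𝔽₃
  basis zero    a = 1₃
  basis (suc u) a = δ-fin (suc u) a

  coord : (Fin D → 𝔽₃) → Fin D → 𝔽₃
  coord φ zero    = φ zero
  coord φ (suc u) = φ (suc u) -₃ φ zero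

  coord-expansion : ∀ (φ : Fin D → 𝔽₃) a → ∑ (fins D) (λ u → coord φ u *₃ basis u a) ≡ φ a
  coord-expansion φ zero
    rewrite ∑-map suc (fins m) (λ u → coord φ u *₃ basis u zero)
          | ∑-zero (fins m) {λ u → coord φ (suc u) *₃ basis (suc u) zero} (λ {u} _ → *₃-zeroʳ (coord φ (suc u)))
          = trans (+₃-identityʳ _) (*₃-identityʳ _)
  coord-expansion φ (suc a)
    rewrite ∑-map suc (fins m) (λ u → coord φ u *₃ basis u (suc a))
          | ∑-δ-fin m (λ u → coord φ (suc u)) a = cancel (φ zero) (φ (suc a))
    where
    cancel : ∀ x y → x *₃ 1₃ +₃ (y -₃ x) ≡ y
    cancel = solve-∀ 𝔽₃-ring

  coord₂ : (Fin D → Fin D → 𝔽₃) → Fin D → Fin D → 𝔽₃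
  coord₂ g u v = coord (λ b → coord (λ a → g a b) u) v

  coord₂-expansion : ∀ (g : Fin D → Fin D → 𝔽₃) a b →
    ∑ (fins D) (λ u → ∑ (fins D) (λ v → coord₂ g u v *₃ (basis u a *₃ basis v b))) ≡ g a b
  coord₂-expansion g a b = begin
      ∑ (fins D) (λ u → ∑ (fins D) (λ v → coord₂ g u v *₃ (basis u a *₃ basis v b)))
    ≡⟨ ∑-cong (fins D) (λ u → ∑-factor (fins D) (basis u a) (λ v → swap (coord₂ g u v) (basis u a) (basis v b))) ⟩
      ∑ (fins D) (λ u → basis u a *₃ ∑ (fins D) (λ v → coord₂ g u v *₃ basis v b))
    ≡⟨ ∑-cong (fins D) (λ u → cong (basis u a *₃_) (coord-expansion (λ b → coord (λ a → g a b) u) b)) ⟩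
      ∑ (fins D) (λ u → basis u a *₃ coord (λ a → g a b) u)
    ≡⟨ ∑-cong (fins D) (λ u → *₃-comm (basis u a) _) ⟩
      ∑ (fins D) (λ u → coord (λ a → g a b) u *₃ basis u a)
    ≡⟨ coord-expansion (λ a → g a b) a ⟩
      g a b ∎
    where
    open ≡-Reasoning
    swap : ∀ x y z → x *₃ (y *₃ z) ≡ y *₃ (x *₃ z)
    swap = solve-∀ 𝔽₃-ring

  δ₀ : Fin D → 𝔽₃
  δ₀ zero    = 1₃
  δ₀ (suc _) = 0₃

  ∑-δ₀ : (G : Fin D → 𝔽₃) → ∑ (fins D) (λ u → δ₀ u *₃ G u) ≡ G zero
  ∑-δ₀ G rewrite ∑-map suc (fins m) (λ u → δ₀ u *₃ G u)
               | ∑-zero (fins m) {λ u → δ₀ (suc u) *₃ G (suc u)} (λ {u} _ → *₃-zeroˡ (G (suc u)))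
               = trans (+₃-identityʳ _) (*₃-identityˡ _)

  ∑³-δ₀₁ : ∀ (G : Fin D → Fin D → Fin D → 𝔽₃) → ∑³ (fins D) (λ u v w → δ₀ u *₃ G u v w) ≡ ∑ (fins D) (λ v → ∑ (fins D) (G zero v))
  ∑³-δ₀₁ G = trans (∑-cong (fins D) {g = λ u → δ₀ u *₃ ∑ (fins D) (λ v → ∑ (fins D) (G u v))}
                     (λ u → ∑-factor (fins D) (δ₀ u) (λ v → ∑-factor (fins D) (δ₀ u) {g = G u v} (λ w → refl))))
                   (∑-δ₀ (λ u → ∑ (fins D) (λ v → ∑ (fins D) (G u v))))

  ∑³-δ₀₂ : ∀ (G : Fin D → Fin D → Fin D → 𝔽₃) → ∑³ (fins D) (λ u v w → δ₀ v *₃ G u v w) ≡ ∑ (fins D) (λ u → ∑ (fins D) (G u zero))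
  ∑³-δ₀₂ G = ∑-cong (fins D) (λ u → trans (∑-cong (fins D) (λ v → ∑-factor (fins D) (δ₀ v) {g = G u v} (λ w → refl)))
                                          (∑-δ₀ (λ v → ∑ (fins D) (G u v))))

  ∑³-δ₀₃ : ∀ (G : Fin D → Fin D → Fin D → 𝔽₃) → ∑³ (fins D) (λ u v w → δ₀ w *₃ G u v w) ≡ ∑ (fins D) (λ u → ∑ (fins D) (λ v → G u v zero))
  ∑³-δ₀₃ G = ∑-cong (fins D) (λ u → ∑-cong (fins D) (λ v → ∑-δ₀ (G u v)))

  -- 1 − δ(a,b) − δ(b,c) − δ(a,c) is 1 (= −2) if a = b = c, 1 if a, b, c are distinct, and 0 otherwise.
  sunflowerPoly : Fin D → Fin D → Fin D → 𝔽₃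
  sunflowerPoly a b c = 1₃ -₃ δ-fin a b -₃ δ-fin b c -₃ δ-fin a c

  δ-coord : Fin D → Fin D → 𝔽₃
  δ-coord = coord₂ δ-fin

  sunflowerCoord : Fin D → Fin D → Fin D → 𝔽₃
  sunflowerCoord u v w = δ₀ u *₃ δ₀ v *₃ δ₀ w -₃ δ-coord u v *₃ δ₀ w -₃ δ-coord v w *₃ δ₀ u -₃ δ-coord u w *₃ δ₀ v

  sunflowerPoly-expansion : ∀ a b c → trilinear (fins D) basis sunflowerCoord a b c ≡ sunflowerPoly a b c
  sunflowerPoly-expansion a b c = begin
      ∑³ (fins D) (λ u v w → sunflowerCoord u v w *₃ B u v w)
    ≡⟨ ∑³-cong (fins D) (λ u v w → distrib (δ₀ u) (δ₀ v) (δ₀ w) (δ-coord u v) (δ-coord v w) (δ-coord u w) (B u v w)) ⟩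
      ∑³ (fins D) (λ u v w → T₀ u v w -₃ Tab u v w -₃ Tbc u v w -₃ Tac u v w)
    ≡⟨ trans (∑³-- (fins D) _ Tac) (cong₂ _-₃_ (trans (∑³-- (fins D) _ Tbc) (cong₂ _-₃_ (∑³-- (fins D) T₀ Tab) refl)) refl) ⟩
      ∑³ (fins D) T₀ -₃ ∑³ (fins D) Tab -₃ ∑³ (fins D) Tbc -₃ ∑³ (fins D) Tac
    ≡⟨ cong₂ _-₃_ (cong₂ _-₃_ (cong₂ _-₃_ constant-term ab-term) bc-term) ac-term ⟩
      sunflowerPoly a b c ∎
    where
    open ≡-Reasoning
    B : Fin D → Fin D → Fin D → 𝔽₃
    B u v w = basis u a *₃ (basis v b *₃ basis w c)
    T₀ Tab Tbc Tac : Fin D → Fin D → Fin D → 𝔽₃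
    T₀  u v w = δ₀ w *₃ (δ₀ u *₃ δ₀ v *₃ B u v w)
    Tab u v w = δ₀ w *₃ (δ-coord u v *₃ B u v w)
    Tbc u v w = δ₀ u *₃ (δ-coord v w *₃ B u v w)
    Tac u v w = δ₀ v *₃ (δ-coord u w *₃ B u v w)
    distrib : ∀ x y z e₁ e₂ e₃ p →
              (x *₃ y *₃ z -₃ e₁ *₃ z -₃ e₂ *₃ x -₃ e₃ *₃ y) *₃ p
              ≡ z *₃ (x *₃ y *₃ p) -₃ z *₃ (e₁ *₃ p) -₃ x *₃ (e₂ *₃ p) -₃ y *₃ (e₃ *₃ p)
    distrib = solve-∀ 𝔽₃-ring
    constant-term : ∑³ (fins D) T₀ ≡ 1₃
    constant-term = begin
        _
      ≡⟨ ∑³-δ₀₃ (λ u v w → δ₀ u *₃ δ₀ v *₃ B u v w) ⟩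
        ∑ (fins D) (λ u → ∑ (fins D) (λ v → δ₀ u *₃ δ₀ v *₃ B u v zero))
      ≡⟨ ∑-cong (fins D) (λ u → trans (∑-cong (fins D) (λ v → swap (δ₀ u) (δ₀ v) (B u v zero)))
                                      (∑-δ₀ (λ v → δ₀ u *₃ B u v zero))) ⟩
        ∑ (fins D) (λ u → δ₀ u *₃ B u zero zero)
      ≡⟨ ∑-δ₀ (λ u → B u zero zero) ⟩
        1₃ ∎
      where
      swap : ∀ x y p → x *₃ y *₃ p ≡ y *₃ (x *₃ p)
      swap = solve-∀ 𝔽₃-ring
    ab-term : ∑³ (fins D) Tab ≡ δ-fin a b
    ab-term = begin
        _
      ≡⟨ ∑³-δ₀₃ (λ u v w → δ-coord u v *₃ B u v w) ⟩
        ∑ (fins D) (λ u → ∑ (fins D) (λ v → δ-coord u v *₃ (basis u a *₃ (basis v b *₃ 1₃))))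
      ≡⟨ ∑-cong (fins D) (λ u → ∑-cong (fins D) (λ v → cong (λ t → δ-coord u v *₃ (basis u a *₃ t)) (*₃-identityʳ (basis v b)))) ⟩
        ∑ (fins D) (λ u → ∑ (fins D) (λ v → δ-coord u v *₃ (basis u a *₃ basis v b)))
      ≡⟨ coord₂-expansion δ-fin a b ⟩
        δ-fin a b ∎
    bc-term : ∑³ (fins D) Tbc ≡ δ-fin b c
    bc-term = trans (∑³-δ₀₁ (λ u v w → δ-coord v w *₃ B u v w))
                    (trans (∑-cong (fins D) (λ v → ∑-cong (fins D) (λ w → cong (δ-coord v w *₃_) (*₃-identityˡ _))))
                           (coord₂-expansion δ-fin b c))
    ac-term : ∑³ (fins D) Tac ≡ δ-fin a c
    ac-term = trans (∑³-δ₀₂ (λ u v w → δ-coord u w *₃ B u v w))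
                    (trans (∑-cong (fins D) (λ u → ∑-cong (fins D) (λ w → cong (λ t → δ-coord u w *₃ (basis u a *₃ t)) (*₃-identityˡ _))))
                           (coord₂-expansion δ-fin a c))

  vectors : (N : ℕ) → List (Vecs D N)
  vectors zero    = [] ∷ []
  vectors (suc N) = cartesianProductWith _∷_ (fins D) (vectors N)

  monomial : ∀ {N} → Vecs D N → Vecs D N → 𝔽₃
  monomial []      []      = 1₃
  monomial (u ∷ α) (a ∷ x) = basis u a *₃ monomial α x

  coeff : ∀ {N} → Vecs D N → Vecs D N → Vecs D N → 𝔽₃
  coeff []      []      []      = 1₃
  coeff (u ∷ α) (v ∷ β) (w ∷ γ) = sunflowerCoord u v w *₃ coeff α β γ

  sunflowerTensor : ∀ {N} → Vecs D N → Vecs D N → Vecs D N → 𝔽₃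
  sunflowerTensor []      []      []      = 1₃
  sunflowerTensor (a ∷ x) (b ∷ y) (c ∷ z) = sunflowerPoly a b c *₃ sunflowerTensor x y z

  sunflowerTensor-expansion : ∀ {N} (x y z : Vecs D N) → sunflowerTensor x y z ≡ trilinear (vectors N) monomial coeff x y z
  sunflowerTensor-expansion []      []      []      = refl
  sunflowerTensor-expansion {suc N} (a ∷ x) (b ∷ y) (c ∷ z) = begin
      sunflowerPoly a b c *₃ sunflowerTensor x y z
    ≡⟨ cong₂ _*₃_ (sym (sunflowerPoly-expansion a b c)) (sunflowerTensor-expansion x y z) ⟩
      ∑³ (fins D) P *₃ ∑³ (vectors N) Q
    ≡⟨ ∑³-*ʳ (fins D) (∑³ (vectors N) Q) P ⟩
      ∑³ (fins D) (λ u v w → P u v w *₃ ∑³ (vectors N) Q)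
    ≡⟨ ∑³-cong (fins D) (λ u v w → ∑³-*ˡ (vectors N) (P u v w) Q) ⟩
      ∑³ (fins D) (λ u v w → ∑³ (vectors N) (λ α β γ → P u v w *₃ Q α β γ))
    ≡⟨ ∑³-cong (fins D) (λ u v w → ∑³-cong (vectors N) (λ α β γ → regroup (sunflowerCoord u v w)
         (basis u a) (basis v b) (basis w c) (coeff α β γ) (monomial α x) (monomial β y) (monomial γ z))) ⟩
      ∑³ (fins D) (λ u v w → ∑³ (vectors N) (λ α β γ → R (u ∷ α) (v ∷ β) (w ∷ γ)))
    ≡⟨ sym (∑³-cartesianProductWith _∷_ (fins D) (vectors N) R) ⟩
      ∑³ (vectors (suc N)) R ∎
    where
    open ≡-Reasoning
    P : Fin D → Fin D → Fin D → 𝔽₃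
    P u v w = sunflowerCoord u v w *₃ (basis u a *₃ (basis v b *₃ basis w c))
    Q : Vecs D N → Vecs D N → Vecs D N → 𝔽₃
    Q α β γ = coeff α β γ *₃ (monomial α x *₃ (monomial β y *₃ monomial γ z))
    R : Vecs D (suc N) → Vecs D (suc N) → Vecs D (suc N) → 𝔽₃
    R α β γ = coeff α β γ *₃ (monomial α (a ∷ x) *₃ (monomial β (b ∷ y) *₃ monomial γ (c ∷ z)))
    regroup : ∀ s p q r k mα mβ mγ → s *₃ (p *₃ (q *₃ r)) *₃ (k *₃ (mα *₃ (mβ *₃ mγ)))
                                    ≡ s *₃ k *₃ (p *₃ mα *₃ (q *₃ mβ *₃ (r *₃ mγ)))
    regroup = solve-∀ 𝔽₃-ring

  degree₁ : Fin D → ℕ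
  degree₁ zero    = 0
  degree₁ (suc _) = 1

  degree : ∀ {N} → Vecs D N → ℕ
  degree []      = 0
  degree (u ∷ α) = degree₁ u + degree α

  sunflowerCoord-degree : ∀ u v w → sunflowerCoord u v w ≢ 0₃ → degree₁ u + degree₁ v + degree₁ w ≤ 2
  sunflowerCoord-degree zero    zero    zero    _ = z≤n
  sunflowerCoord-degree zero    zero    (suc w) _ = s≤s z≤n
  sunflowerCoord-degree zero    (suc v) zero    _ = s≤s z≤n
  sunflowerCoord-degree zero    (suc v) (suc w) _ = s≤s (s≤s z≤n)
  sunflowerCoord-degree (suc u) zero    zero    _ = s≤s z≤n
  sunflowerCoord-degree (suc u) zero    (suc w) _ = s≤s (s≤s z≤n)
  sunflowerCoord-degree (suc u) (suc v) zero    _ = s≤s (s≤s z≤n)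
  sunflowerCoord-degree (suc u) (suc v) (suc w) c≢0 = ⊥-elim (c≢0 (vanishes (δ-coord (suc u) (suc v)) (δ-coord (suc v) (suc w)) (δ-coord (suc u) (suc w))))
    where
    vanishes : ∀ p q r → 0₃ *₃ 0₃ *₃ 0₃ -₃ p *₃ 0₃ -₃ q *₃ 0₃ -₃ r *₃ 0₃ ≡ 0₃
    vanishes = solve-∀ 𝔽₃-ring

  coeff-degree : ∀ {N} (α β γ : Vecs D N) → coeff α β γ ≢ 0₃ → degree α + degree β + degree γ ≤ 2 * N
  coeff-degree []      []      []      _ = z≤n
  coeff-degree {suc N} (u ∷ α) (v ∷ β) (w ∷ γ) c≢0 =
    subst₂ _≤_ (sym (regroup (degree₁ u) (degree₁ v) (degree₁ w) (degree α) (degree β) (degree γ))) (sym (double-suc N))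
      (+-mono-≤ (sunflowerCoord-degree u v w (λ e → c≢0 (trans (cong (_*₃ coeff α β γ) e) (*₃-zeroˡ (coeff α β γ)))))
                (coeff-degree α β γ (λ e → c≢0 (trans (cong (sunflowerCoord u v w *₃_) e) (*₃-zeroʳ (sunflowerCoord u v w))))))
    where
    regroup : ∀ a b c x y z → a + x + (b + y) + (c + z) ≡ (a + b + c) + (x + y + z)
    regroup = ℕ-Solver.solve-∀
    double-suc : ∀ N → 2 * suc N ≡ 2 + 2 * N
    double-suc = ℕ-Solver.solve-∀

  sunflowerPoly-values : ∀ {a b c p q r} → δ-fin a b ≡ p → δ-fin b c ≡ q → δ-fin a c ≡ r →
                         sunflowerPoly a b c ≡ 1₃ -₃ p -₃ q -₃ r
  sunflowerPoly-values refl refl refl = refl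

  sunflowerPoly-support : ∀ a b c → sunflowerPoly a b c ≢ 0₃ → AllEqual a b c ⊎ AllDistinct a b c
  sunflowerPoly-support a b c f≢0 = cases (a Fin.≟ b) (b Fin.≟ c) (a Fin.≟ c)
    where
    open Kronecker (Fin._≟_ {D})
    cases : Dec (a ≡ b) → Dec (b ≡ c) → Dec (a ≡ c) → AllEqual a b c ⊎ AllDistinct a b c
    cases (yes ab) (yes bc) _        = inj₁ (ab , bc)
    cases (yes ab) (no  bc) (yes ac) = ⊥-elim (bc (trans (sym ab) ac))
    cases (no  ab) (yes bc) (yes ac) = ⊥-elim (ab (trans ac (sym bc)))
    cases (yes ab) (no  bc) (no  ac) = ⊥-elim (f≢0 (sunflowerPoly-values {a} {b} {c} (δ-≡ ab) (δ-≢ bc) (δ-≢ ac)))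
    cases (no  ab) (yes bc) (no  ac) = ⊥-elim (f≢0 (sunflowerPoly-values {a} {b} {c} (δ-≢ ab) (δ-≡ bc) (δ-≢ ac)))
    cases (no  ab) (no  bc) (yes ac) = ⊥-elim (f≢0 (sunflowerPoly-values {a} {b} {c} (δ-≢ ab) (δ-≢ bc) (δ-≡ ac)))
    cases (no  ab) (no  bc) (no  ac) = inj₂ (ab , bc , ac)

  sunflowerTensor-support : ∀ {N} (x y z : Vecs D N) → sunflowerTensor x y z ≢ 0₃ → Sunflower x y z
  sunflowerTensor-support (a ∷ x) (b ∷ y) (c ∷ z) T≢0 zero =
    sunflowerPoly-support a b c (λ e → T≢0 (trans (cong (_*₃ sunflowerTensor x y z) e) (*₃-zeroˡ (sunflowerTensor x y z))))
  sunflowerTensor-support (a ∷ x) (b ∷ y) (c ∷ z) T≢0 (suc i) =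
    sunflowerTensor-support x y z (λ e → T≢0 (trans (cong (sunflowerPoly a b c *₃_) e) (*₃-zeroʳ (sunflowerPoly a b c)))) i

  sunflowerTensor-refl : ∀ {N} (x : Vecs D N) → sunflowerTensor x x x ≡ 1₃
  sunflowerTensor-refl []      = refl
  sunflowerTensor-refl (a ∷ x) = cong₂ _*₃_ (sunflowerPoly-values {a} {a} {a} δ-aa δ-aa δ-aa) (sunflowerTensor-refl x)
    where
    δ-aa : δ-fin a a ≡ 1₃
    δ-aa = Kronecker.δ-≡ Fin._≟_ {a} refl

  _≟ⱽ_ : ∀ {N} → DecidableEquality (Vecs D N)
  _≟ⱽ_ = Vec.≡-dec Fin._≟_

  module _ {N} {A : List (Vecs D N)} (sfA : SunflowerFree A) where

    open Kronecker (_≟ⱽ_ {N})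

    sunflowerTensor-nontrivial : ∀ {x y z} → x ∈ A → y ∈ A → z ∈ A → ¬ (x ≡ y × y ≡ z) → sunflowerTensor x y z ≡ 0₃
    sunflowerTensor-nontrivial {x} {y} {z} x∈ y∈ z∈ nontrivial with sunflowerTensor x y z ≟₃ 0₃
    ... | yes T≡0 = T≡0
    ... | no  T≢0 with sunflower-equal⊎distinct x y z (sunflowerTensor-support x y z T≢0)
    ...   | inj₁ trivial                = ⊥-elim (nontrivial trivial)
    ...   | inj₂ (x≢y , y≢z , x≢z)      = ⊥-elim (sfA x y z x∈ y∈ z∈ x≢y y≢z x≢z (sunflowerTensor-support x y z T≢0))

    sunflowerTensor-diagonal : ∀ {x y z} → x ∈ A → y ∈ A → z ∈ A → sunflowerTensor x y z ≡ δ x y *₃ δ y z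
    sunflowerTensor-diagonal {x} {y} {z} x∈ y∈ z∈ with x ≟ⱽ y | y ≟ⱽ z
    ... | yes refl | yes refl = sunflowerTensor-refl x
    ... | yes refl | no  y≢z = sunflowerTensor-nontrivial x∈ y∈ z∈ (y≢z ∘′ proj₂)
    ... | no  x≢y  | _        = trans (sunflowerTensor-nontrivial x∈ y∈ z∈ (x≢y ∘′ proj₁)) (sym (*₃-zeroˡ (δ y z)))

∑ℕ : {X : Set} → List X → (X → ℕ) → ℕ
∑ℕ []       g = 0
∑ℕ (x ∷ xs) g = g x + ∑ℕ xs g

module _ {X : Set} where

  ∑ℕ-++ : (xs ys : List X) (g : X → ℕ) → ∑ℕ (xs ++ ys) g ≡ ∑ℕ xs g + ∑ℕ ys g
  ∑ℕ-++ []       ys g = refl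
  ∑ℕ-++ (x ∷ xs) ys g = trans (cong (g x +_) (∑ℕ-++ xs ys g)) (sym (+-assoc (g x) _ _))

  ∑ℕ-*ˡ : (xs : List X) (c : ℕ) (g : X → ℕ) → ∑ℕ xs (λ x → c * g x) ≡ c * ∑ℕ xs g
  ∑ℕ-*ˡ []       c g = sym (*-zeroʳ c)
  ∑ℕ-*ˡ (x ∷ xs) c g = trans (cong (c * g x +_) (∑ℕ-*ˡ xs c g)) (sym (*-distribˡ-+ c (g x) (∑ℕ xs g)))

  ∑ℕ-*ʳ : (xs : List X) (c : ℕ) (g : X → ℕ) → ∑ℕ xs (λ x → g x * c) ≡ ∑ℕ xs g * c
  ∑ℕ-*ʳ []       c g = refl
  ∑ℕ-*ʳ (x ∷ xs) c g = trans (cong (g x * c +_) (∑ℕ-*ʳ xs c g)) (sym (*-distribʳ-+ c (g x) (∑ℕ xs g)))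

  ∑ℕ-cong : (xs : List X) {f g : X → ℕ} → (∀ x → f x ≡ g x) → ∑ℕ xs f ≡ ∑ℕ xs g
  ∑ℕ-cong []       eq = refl
  ∑ℕ-cong (x ∷ xs) eq = cong₂ _+_ (eq x) (∑ℕ-cong xs eq)

  ∑ℕ-const : (xs : List X) (c : ℕ) → ∑ℕ xs (λ _ → c) ≡ c * length xs
  ∑ℕ-const []       c = sym (*-zeroʳ c)
  ∑ℕ-const (x ∷ xs) c = trans (cong (c +_) (∑ℕ-const xs c)) (sym (*-suc c (length xs)))

  ∑ℕ-filter : {P : X → Set} (P? : (x : X) → Dec (P x)) (xs : List X) (c : ℕ) (g : X → ℕ) →
              (∀ x → P x → c ≤ g x) → length (filter P? xs) * c ≤ ∑ℕ xs g
  ∑ℕ-filter P? []       c g c≤g = z≤n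
  ∑ℕ-filter P? (x ∷ xs) c g c≤g with P? x
  ... | yes px = +-mono-≤ (c≤g x px) (∑ℕ-filter P? xs c g c≤g)
  ... | no  _  = ≤-trans (∑ℕ-filter P? xs c g c≤g) (m≤n+m _ (g x))

∑ℕ-map : {X Y : Set} (h : X → Y) (xs : List X) (g : Y → ℕ) → ∑ℕ (map h xs) g ≡ ∑ℕ xs (g ∘ h)
∑ℕ-map h []       g = refl
∑ℕ-map h (x ∷ xs) g = cong (g (h x) +_) (∑ℕ-map h xs g)

∑ℕ-cartesianProductWith : {X Y Z : Set} (f : X → Y → Z) (xs : List X) (ys : List Y) (g : Z → ℕ) →
                          ∑ℕ (cartesianProductWith f xs ys) g ≡ ∑ℕ xs (λ x → ∑ℕ ys (λ y → g (f x y)))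
∑ℕ-cartesianProductWith f []       ys g = refl
∑ℕ-cartesianProductWith f (x ∷ xs) ys g =
  trans (∑ℕ-++ (map (f x) ys) _ g) (cong₂ _+_ (∑ℕ-map (f x) ys g) (∑ℕ-cartesianProductWith f xs ys g))

length-fins : ∀ k → length (fins k) ≡ k
length-fins zero    = refl
length-fins (suc k) = cong suc (trans (List.length-map suc (fins k)) (length-fins k))

^-distribʳ-* : ∀ x y k → (x * y) ^ k ≡ x ^ k * y ^ k
^-distribʳ-* x y zero    = refl
^-distribʳ-* x y (suc k) = trans (cong (x * y *_) (^-distribʳ-* x y k)) (interchange x y (x ^ k) (y ^ k))
  where
  interchange : ∀ x y p q → x * y * (p * q) ≡ x * p * (y * q)
  interchange = ℕ-Solver.solve-∀

-- Counting vectors of low degree with weights  m  (coordinate 0) and  2  (coordinate ≠ 0):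
-- the weights sum to (3m)^N, and a vector of degree ≤ K has weight ≥ (2/m)^K m^N.
module LowDegree (m : ℕ) where

  open SunflowerPolynomial m

  weight₁ : Fin D → ℕ
  weight₁ zero    = m
  weight₁ (suc _) = 2

  weight : ∀ {N} → Vecs D N → ℕ
  weight []      = 1
  weight (u ∷ α) = weight₁ u * weight α

  ∑-weight₁ : ∑ℕ (fins D) weight₁ ≡ 3 * m
  ∑-weight₁ = begin
      m + ∑ℕ (map suc (fins m)) weight₁
    ≡⟨ cong (m +_) (trans (∑ℕ-map suc (fins m) weight₁) (∑ℕ-const (fins m) 2)) ⟩
      m + 2 * length (fins m)
    ≡⟨ cong (λ l → m + 2 * l) (length-fins m) ⟩
      m + 2 * m
    ≡⟨ triple m ⟩
      3 * m ∎
    where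
    open ≡-Reasoning
    triple : ∀ m → m + 2 * m ≡ 3 * m
    triple = ℕ-Solver.solve-∀

  ∑-weight : ∀ N → ∑ℕ (vectors N) weight ≡ (3 * m) ^ N
  ∑-weight zero    = refl
  ∑-weight (suc N) = begin
      ∑ℕ (vectors (suc N)) weight
    ≡⟨ ∑ℕ-cartesianProductWith _∷_ (fins D) (vectors N) weight ⟩
      ∑ℕ (fins D) (λ u → ∑ℕ (vectors N) (λ α → weight₁ u * weight α))
    ≡⟨ ∑ℕ-cong (fins D) (λ u → ∑ℕ-*ˡ (vectors N) (weight₁ u) weight) ⟩
      ∑ℕ (fins D) (λ u → weight₁ u * ∑ℕ (vectors N) weight)
    ≡⟨ ∑ℕ-*ʳ (fins D) (∑ℕ (vectors N) weight) weight₁ ⟩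
      ∑ℕ (fins D) weight₁ * ∑ℕ (vectors N) weight
    ≡⟨ cong₂ _*_ ∑-weight₁ (∑-weight N) ⟩
      3 * m * (3 * m) ^ N ∎
    where open ≡-Reasoning

  weight-degree : ∀ {N} (α : Vecs D N) → weight α * m ^ degree α ≡ 2 ^ degree α * m ^ N
  weight-degree [] = refl
  weight-degree {suc N} (zero ∷ α) = begin
      m * weight α * m ^ degree α
    ≡⟨ *-assoc m (weight α) _ ⟩
      m * (weight α * m ^ degree α)
    ≡⟨ cong (m *_) (weight-degree α) ⟩
      m * (2 ^ degree α * m ^ N)
    ≡⟨ regroup m (2 ^ degree α) (m ^ N) ⟩
      2 ^ degree α * (m * m ^ N) ∎
    where
    open ≡-Reasoning
    regroup : ∀ m p q → m * (p * q) ≡ p * (m * q)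
    regroup = ℕ-Solver.solve-∀
  weight-degree {suc N} (suc u ∷ α) = begin
      2 * weight α * (m * m ^ degree α)
    ≡⟨ regroup₁ m (weight α) (m ^ degree α) ⟩
      2 * m * (weight α * m ^ degree α)
    ≡⟨ cong (2 * m *_) (weight-degree α) ⟩
      2 * m * (2 ^ degree α * m ^ N)
    ≡⟨ regroup₂ m (2 ^ degree α) (m ^ N) ⟩
      2 * 2 ^ degree α * (m * m ^ N) ∎
    where
    open ≡-Reasoning
    regroup₁ : ∀ m w p → 2 * w * (m * p) ≡ 2 * m * (w * p)
    regroup₁ = ℕ-Solver.solve-∀
    regroup₂ : ∀ m p q → 2 * m * (p * q) ≡ 2 * p * (m * q)
    regroup₂ = ℕ-Solver.solve-∀

  lowDegree-weight : 2 ≤ m → ∀ {N} K (α : Vecs D N) → degree α ≤ K → 2 ^ K * m ^ N ≤ m ^ K * weight α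
  lowDegree-weight m≥2 {N} K α d≤K = begin
      2 ^ K * m ^ N
    ≡⟨ cong (λ t → 2 ^ t * m ^ N) (sym (m∸n+n≡m d≤K)) ⟩
      2 ^ (j + d) * m ^ N
    ≡⟨ trans (cong (_* m ^ N) (^-distribˡ-+-* 2 j d)) (*-assoc (2 ^ j) (2 ^ d) (m ^ N)) ⟩
      2 ^ j * (2 ^ d * m ^ N)
    ≡⟨ cong (2 ^ j *_) (sym (weight-degree α)) ⟩
      2 ^ j * (weight α * m ^ d)
    ≤⟨ *-monoˡ-≤ (weight α * m ^ d) (^-monoˡ-≤ j m≥2) ⟩
      m ^ j * (weight α * m ^ d)
    ≡⟨ regroup (m ^ j) (weight α) (m ^ d) ⟩
      m ^ j * m ^ d * weight α
    ≡⟨ cong (_* weight α) (sym (^-distribˡ-+-* m j d)) ⟩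
      m ^ (j + d) * weight α
    ≡⟨ cong (λ t → m ^ t * weight α) (m∸n+n≡m d≤K) ⟩
      m ^ K * weight α ∎
    where
    open ≤-Reasoning
    d j : ℕ
    d = degree α
    j = K ∸ d
    regroup : ∀ a b c → a * (b * c) ≡ a * c * b
    regroup = ℕ-Solver.solve-∀

  lowDegree-count : 2 ≤ m → ∀ N K → length (filter (λ α → degree α ≤? K) (vectors N)) * (2 ^ K * m ^ N) ≤ m ^ K * (3 * m) ^ N
  lowDegree-count m≥2 N K = begin
      length (filter (λ α → degree α ≤? K) (vectors N)) * (2 ^ K * m ^ N)
    ≤⟨ ∑ℕ-filter (λ α → degree α ≤? K) (vectors N) _ (λ α → m ^ K * weight α) (lowDegree-weight m≥2 K) ⟩
      ∑ℕ (vectors N) (λ α → m ^ K * weight α)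
    ≡⟨ trans (∑ℕ-*ˡ (vectors N) (m ^ K) weight) (cong (m ^ K *_) (∑-weight N)) ⟩
      m ^ K * (3 * m) ^ N ∎
    where open ≤-Reasoning

pigeonhole₃ : ∀ a b c K → a + b + c ≤ 3 * K → a ≤ K ⊎ b ≤ K ⊎ c ≤ K
pigeonhole₃ a b c K sum≤ with a ≤? K | b ≤? K | c ≤? K
... | yes a≤K | _       | _       = inj₁ a≤K
... | no  _   | yes b≤K | _       = inj₂ (inj₁ b≤K)
... | no  _   | no  _   | yes c≤K = inj₂ (inj₂ c≤K)
... | no  a>K | no  b>K | no  c>K = contradiction (≤-trans (+-mono-≤ (+-mono-≤ (≰⇒> a>K) (≰⇒> b>K)) (≰⇒> c>K)) sum≤) (too-big K)
  where
  too-big : ∀ K → ¬ (suc K + suc K + suc K ≤ 3 * K)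
  too-big K le = <-irrefl refl (≤-trans (m≤m+n (suc (3 * K)) 2) (≤-trans (≤-reflexive (three-suc K)) le))
    where
    three-suc : ∀ K → suc (3 * K) + 2 ≡ suc K + suc K + suc K
    three-suc = ℕ-Solver.solve-∀

sunflowerFree-bound : ∀ m → 2 ≤ m → ∀ {N} n′ → N ≡ 3 * n′ → (A : List (Vecs (suc m) N)) → Unique A → SunflowerFree A →
                      4 ^ n′ * length A ≤ 3 * (27 ^ n′ * m ^ (2 * n′))
sunflowerFree-bound m m≥2 n′ refl A uA sfA = begin
    4 ^ n′ * length A
  ≤⟨ *-monoʳ-≤ (4 ^ n′) slice-rank ⟩
    4 ^ n′ * (3 * length small)
  ≡⟨ regroup (4 ^ n′) (length small) ⟩
    3 * (length small * 4 ^ n′)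
  ≤⟨ *-monoʳ-≤ 3 small-count ⟩
    3 * (m ^ K * 27 ^ n′)
  ≡⟨ cong (3 *_) (*-comm (m ^ K) (27 ^ n′)) ⟩
    3 * (27 ^ n′ * m ^ K) ∎
  where
  open ≤-Reasoning
  open SunflowerPolynomial m
  open LowDegree m

  N K : ℕ
  N = 3 * n′
  K = 2 * n′

  small-slot : ∀ α β γ → coeff α β γ ≢ 0₃ → degree α ≤ K ⊎ degree β ≤ K ⊎ degree γ ≤ K
  small-slot α β γ c≢0 = pigeonhole₃ _ _ _ K (subst (degree α + degree β + degree γ ≤_) (six n′) (coeff-degree α β γ c≢0))
    where
    six : ∀ n′ → 2 * (3 * n′) ≡ 3 * (2 * n′)
    six = ℕ-Solver.solve-∀

  open SliceRank _≟ⱽ_ (vectors N) monomial coeff (λ α → degree α ≤? K) small-slot A uA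
         (λ {x} {y} {z} x∈ y∈ z∈ → trans (sym (sunflowerTensor-expansion x y z)) (sunflowerTensor-diagonal sfA x∈ y∈ z∈))
    using (small) renaming (bound to slice-rank)

  cube-power : (3 * m) ^ N ≡ 27 ^ n′ * m ^ N
  cube-power = begin-equality
      (3 * m) ^ (3 * n′)
    ≡⟨ sym (^-*-assoc (3 * m) 3 n′) ⟩
      ((3 * m) ^ 3) ^ n′
    ≡⟨ cong (_^ n′) (^-distribʳ-* 3 m 3) ⟩
      (27 * m ^ 3) ^ n′
    ≡⟨ ^-distribʳ-* 27 (m ^ 3) n′ ⟩
      27 ^ n′ * (m ^ 3) ^ n′
    ≡⟨ cong (27 ^ n′ *_) (^-*-assoc m 3 n′) ⟩
      27 ^ n′ * m ^ N ∎

  small-count : length small * 4 ^ n′ ≤ m ^ K * 27 ^ n′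
  small-count = *-cancelʳ-≤ _ _ (m ^ N) {{m^n≢0 m N {{>-nonZero (≤-trans (s≤s z≤n) m≥2)}}}}
    (subst₂ _≤_ (trans (cong (λ t → length small * (t * m ^ N)) (sym (^-*-assoc 2 2 n′))) (sym (*-assoc (length small) _ _)))
                (trans (cong (m ^ K *_) cube-power) (sym (*-assoc (m ^ K) _ _)))
                (lowDegree-count m≥2 N K))

  regroup : ∀ a l → a * (3 * l) ≡ 3 * (l * a)
  regroup = ℕ-Solver.solve-∀

power : ∀ {D n} → List (Vecs D n) → (k : ℕ) → List (Vecs D (k * n))
power A zero    = [] ∷ []
power A (suc k) = cartesianProductWith _++ᵛ_ A (power A k)

length-cartesianProductWith : {X Y Z : Set} (f : X → Y → Z) (xs : List X) (ys : List Y) →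
                              length (cartesianProductWith f xs ys) ≡ length xs * length ys
length-cartesianProductWith f []       ys = refl
length-cartesianProductWith f (x ∷ xs) ys =
  trans (List.length-++ (map (f x) ys)) (cong₂ _+_ (List.length-map (f x) ys) (length-cartesianProductWith f xs ys))

length-power : ∀ {D n} (A : List (Vecs D n)) k → length (power A k) ≡ length A ^ k
length-power A zero    = refl
length-power A (suc k) = trans (length-cartesianProductWith _++ᵛ_ A (power A k)) (cong (length A *_) (length-power A k))

power-unique : ∀ {D n} {A : List (Vecs D n)} → Unique A → ∀ k → Unique (power A k)
power-unique uA zero    = [] ∷ []
power-unique uA (suc k) =
  Unique.cartesianProductWith⁺ _++ᵛ_ (λ {a} {b} e → Vec.++-injectiveˡ a b e , Vec.++-injectiveʳ a b e) uA (power-unique uA k)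

sunflower-++⁻ : ∀ {D n k} (a b c : Vecs D n) {x y z : Vecs D k} →
                Sunflower (a ++ᵛ x) (b ++ᵛ y) (c ++ᵛ z) → Sunflower a b c × Sunflower x y z
sunflower-++⁻ []      []      []      s = (λ ()) , s
sunflower-++⁻ (a ∷ as) (b ∷ bs) (c ∷ cs) s with sunflower-++⁻ as bs cs (λ i → s (suc i))
... | s₁ , s₂ = (λ { zero → s zero ; (suc i) → s₁ i }) , s₂

power-sunflowerFree : ∀ {D n} {A : List (Vecs D n)} → SunflowerFree A → ∀ k → SunflowerFree (power A k)
power-sunflowerFree sfA zero [] [] [] _ _ _ x≢y _ _ _ = x≢y refl
power-sunflowerFree {A = A} sfA (suc k) x y z x∈ y∈ z∈ x≢y y≢z x≢z s
  with ∈-cartesianProductWith⁻ _++ᵛ_ A (power A k) x∈ | ∈-cartesianProductWith⁻ _++ᵛ_ A (power A k) y∈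
     | ∈-cartesianProductWith⁻ _++ᵛ_ A (power A k) z∈
... | a , x′ , a∈ , x′∈ , refl | b , y′ , b∈ , y′∈ , refl | c , z′ , c∈ , z′∈ , refl
  with sunflower-++⁻ a b c s
... | s₁ , s₂ with sunflower-equal⊎distinct a b c s₁ | sunflower-equal⊎distinct x′ y′ z′ s₂
... | inj₁ (refl , refl) | inj₁ (refl , refl)      = x≢y refl
... | inj₂ (a≢b , b≢c , a≢c) | _                    = sfA a b c a∈ b∈ c∈ a≢b b≢c a≢c s₁
... | inj₁ _ | inj₂ (x′≢y′ , y′≢z′ , x′≢z′) = power-sunflowerFree sfA k x′ y′ z′ x′∈ y′∈ z′∈ x′≢y′ y′≢z′ x′≢z′ s₂

-- Bernoulli's inequality (1 + 1/b)^k ≥ 1 + k/b, cleared of denominators.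
bernoulli : ∀ b k → b ^ k * (b + k) ≤ b * suc b ^ k
bernoulli b zero    = ≤-reflexive (base b)
  where
  base : ∀ b → 1 * (b + 0) ≡ b * 1
  base = ℕ-Solver.solve-∀
bernoulli b (suc k) = begin
    b * b ^ k * (b + suc k)
  ≡⟨ split b (b ^ k) k ⟩
    b * b ^ k * (b + k) + b * b ^ k
  ≤⟨ +-monoʳ-≤ (b * b ^ k * (b + k)) (≤-trans (≤-reflexive (*-comm b (b ^ k))) (*-monoʳ-≤ (b ^ k) (m≤m+n b k))) ⟩
    b * b ^ k * (b + k) + b ^ k * (b + k)
  ≡⟨ factor b (b ^ k) k ⟩
    suc b * (b ^ k * (b + k))
  ≤⟨ *-monoʳ-≤ (suc b) (bernoulli b k) ⟩
    suc b * (b * suc b ^ k)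
  ≡⟨ swap b (suc b ^ k) ⟩
    b * (suc b * suc b ^ k) ∎
  where
  open ≤-Reasoning
  split : ∀ b p k → b * p * (b + suc k) ≡ b * p * (b + k) + b * p
  split = ℕ-Solver.solve-∀
  factor : ∀ b p k → b * p * (b + k) + p * (b + k) ≡ suc b * (p * (b + k))
  factor = ℕ-Solver.solve-∀
  swap : ∀ b q → suc b * (b * q) ≡ b * (suc b * q)
  swap = ℕ-Solver.solve-∀

-- (1 + 1/b)^(3b) ≥ 1 + 3 = 4 by Bernoulli, stated for b + 1 to exclude b = 0.
four≤power : ∀ b → 4 * suc b ^ (3 * suc b) ≤ suc (suc b) ^ (3 * suc b)
four≤power b = *-cancelʳ-≤ _ _ (suc b) (subst₂ _≤_ (regroup (suc b ^ k) (suc b)) (*-comm (suc b) _) (bernoulli (suc b) k))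
  where
  k : ℕ
  k = 3 * suc b
  regroup : ∀ P B → P * (B + 3 * B) ≡ 4 * P * B
  regroup = ℕ-Solver.solve-∀

≤-of-power-bound : ∀ a b → (∀ k → a ^ k ≤ 3 * b ^ k) → a ≤ b
≤-of-power-bound a b bound with a ≤? b
... | yes a≤b = a≤b
... | no  a≰b = contradiction (bound (3 * b)) (too-large b (≰⇒> a≰b) (bound 1))
  where
  too-large : ∀ b → b < a → a ^ 1 ≤ 3 * b ^ 1 → ¬ (a ^ (3 * b) ≤ 3 * b ^ (3 * b))
  too-large zero    0<a a≤0 _ = <⇒≱ 0<a (≤-trans (≤-reflexive (sym (*-identityʳ a))) a≤0)
  too-large (suc b) b<a _ le = <⇒≱ three<four (≤-trans (four≤power b) (≤-trans (^-monoˡ-≤ (3 * suc b) b<a) le))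
    where
    three<four : 3 * suc b ^ (3 * suc b) < 4 * suc b ^ (3 * suc b)
    three<four = *-monoˡ-< (suc b ^ (3 * suc b)) {{m^n≢0 (suc b) (3 * suc b)}} (n<1+n 3)

^-*-interchange : ∀ a b n c k → a ^ (k * n) * b ^ (c * k) ≡ (a ^ n * b ^ c) ^ k
^-*-interchange a b n c k = begin
    a ^ (k * n) * b ^ (c * k)
  ≡⟨ cong₂ _*_ (trans (cong (a ^_) (*-comm k n)) (sym (^-*-assoc a n k))) (sym (^-*-assoc b c k)) ⟩
    (a ^ n) ^ k * (b ^ c) ^ k
  ≡⟨ sym (^-distribʳ-* (a ^ n) (b ^ c) k) ⟩
    (a ^ n * b ^ c) ^ k ∎
  where open ≡-Reasoning

theorem1p5 : (D n : ℕ) → 3 ≤ D → 1 ≤ n →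
    (A : List (Vecs D n)) → Unique A → SunflowerFree A →
      4 ^ n * length A ^ 3 ≤ 27 ^ n * (D ∸ 1) ^ (2 * n)
theorem1p5 (suc (suc zero)) n (s≤s (s≤s ()))
theorem1p5 (suc (suc (suc m₀))) n _ _ A uA sfA =
  ≤-of-power-bound (4 ^ n * length A ^ 3) (27 ^ n * m ^ (2 * n)) λ k →
    subst₂ _≤_ (trans (cong (4 ^ (k * n) *_) (length-power A (3 * k))) (^-*-interchange 4 (length A) n 3 k))
               (cong (3 *_) (trans (cong (λ e → 27 ^ (k * n) * m ^ e) (double k)) (^-*-interchange 27 m n (2 * n) k)))
      (sunflowerFree-bound m (s≤s (s≤s z≤n)) (k * n) (*-assoc 3 k n)
         (power A (3 * k)) (power-unique uA (3 * k)) (power-sunflowerFree sfA (3 * k)))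
  where
  m : ℕ
  m = suc (suc m₀)
  double : ∀ k → 2 * (k * n) ≡ 2 * n * k
  double k = reassoc n k
    where
    reassoc : ∀ n k → 2 * (k * n) ≡ 2 * n * k
    reassoc = ℕ-Solver.solve-∀
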